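{- For every constant $c>2$ there is $n_0$ such that every graph $G$ with $n \ge n_0$ vertices satisfies $\mathrm{fun}(G) \le \sqrt{c\, n \log n}$.
   Context: Here $\log$ denotes the binary logarithm. Functionality: let $G=(V,E)$ be a finite simple graph with adjacency matrix $A$. A vertex $v$ is a function of distinct vertices $u_1,\dots,u_k \in V\setminus\{v\}$ if there is a Boolean function $f:\{0,1\}^k\to\{0,1\}$ such that for every vertex $w \in V\setminus\{v,u_1,\dots,u_k\}$ we have $A[v,w] = f(A[w,u_1],\dots,A[w,u_k])$. The functionality $\mathrm{fun}_G(v)$ is the minimum $k$ such that $v$ is a function of some $k$ vertices of $G$. The functionality of $G$ is $\mathrm{fun}(G)=\max_{H}\min_{v\in V(H)} \mathrm{fun}_H(v)$, the maximum taken over all (nonempty) induced subgraphs $H$ of $G$.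
   Formalization: The constant c ranges only over the rational numbers greater than 2. -}

module Defs where

open import Data.Nat using (ℕ; _*_; _^_; _≤_)
open import Data.Bool using (Bool; false)
open import Data.Fin using (Fin)
open import Data.Fin.Subset using (Subset; _∈_)
open import Data.Product using (Σ; ∃; _×_)
open import Function.Definitions using (Injective)
open import Relation.Binary.PropositionalEquality using (_≡_; _≢_)

record Graph (n : ℕ) : Set where
  field
    adj   : Fin n → Fin n → Bool
    sym   : ∀ u v → adj u v ≡ adj v u
    irrefl : ∀ v → adj v v ≡ false
    
open Graph public

-- Work in the induced subgraph H = G[S].
IsFunctionOf : ∀ {n} (G : Graph n) (S : Subset n) (v : Fin n)
               (k : ℕ) (u : Fin k → Fin n) → Set
IsFunctionOf {n} G S v k u =
  Injective _≡_ _≡_ u ×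
  (∀ i → u i ∈ S) ×
  (∀ i → u i ≢ v) ×
  Σ ((Fin k → Bool) → Bool) λ f →
    ∀ (w : Fin n) → w ∈ S → w ≢ v → (∀ i → w ≢ u i) →
      adj G v w ≡ f (λ i → adj G w (u i))

FunVertexLe : ∀ {n} (G : Graph n) (S : Subset n) (v : Fin n) (k : ℕ) → Set
FunVertexLe G S v k =
  Σ ℕ λ k' → k' ≤ k × Σ (Fin k' → Fin _) λ u → IsFunctionOf G S v k' u

-- The real-number bound  k ≤ sqrt (c · n · log₂ n)  with c = p / q, n ≥ 1,
-- written exactly in ℕ:  k² ≤ (p/q) n log₂ n  ⇔  q k² ≤ p n log₂ n
--                      ⇔  2^(q k²) ≤ n^(p n).
WithinBound : (p q n k : ℕ) → Set
WithinBound p q n k = 2 ^ (q * (k * k)) ≤ n ^ (p * n)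

-- fun(G) ≤ sqrt (c n log n), c = p/q: for every nonempty induced subgraph
-- H = G[S] there is a vertex v of H and a number k with k ≤ sqrt(c n log n)
-- such that fun_H(v) ≤ k.  (Unfolding of  max_H min_v fun_H(v) ≤ bound.)
FunBounded : ∀ {n} (G : Graph n) (p q : ℕ) → Set
FunBounded {n} G p q =
  ∀ (S : Subset n) → (∃ λ x → x ∈ S) →
    Σ (Fin n) λ v → v ∈ S × Σ ℕ λ k → WithinBound p q n k × FunVertexLe G S v k

-- Fix an induced subgraph H on m vertices and a budget k.  If two distinct vertices x, y of
-- H differ on fewer than k vertices, x is a function of y and those vertices.  Otherwise every
-- pair of vertices is separated by at least k vertices, and choosing k vertices greedily, each
-- time the one separating the most pairs not yet separated, leaves at most m² (1 − k/m)^k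
-- unseparated pairs; for k ≈ √(2 m log m) this is below 1, so any vertex outside the chosen
-- set is a function of it.  Finally k² ≲ 2 m log m ≤ c n log n once c > 2 and m is large,
-- while small m are covered by k = m − 1.
module Submission where

open import Defs hiding (sym)
open import Data.Bool using (Bool; true; false; if_then_else_)
import Data.Bool as Bool
open import Data.Fin using (Fin; zero; suc; _≟_)
open import Data.Fin.Properties using (any?; all?; ¬∀⟶∃¬; suc-injective; injective⇒≤; nonZeroIndex)
open import Data.Fin.Subset using (Subset; ⊤)
import Data.Fin.Subset as Subset
open import Data.Fin.Subset.Properties using (∈⊤)
import Data.Fin.Subset.Properties as Subset
open import Data.List using (List; []; _∷_; length)
open import Data.List.Membership.Propositional using (_∈_)
open import Data.List.Relation.Unary.Any using (here; there; toSum)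
open import Data.Nat hiding (_≟_)
open import Data.Nat.DivMod using (_/_; _%_; m≡m%n+[m/n]*n; m%n<n; m/n*n≤m)
open import Data.Nat.Properties hiding (_≟_; suc-injective)
open import Data.Nat.Tactic.RingSolver using (solve-∀)
open import Data.Product using (Σ; ∃; _×_; _,_; proj₂)
import Data.Product as Product
open import Data.Sum using (_⊎_; inj₁; inj₂)
open import Function using (_∘_)
open import Function.Definitions using (Injective)
open import Level using (Level; 0ℓ)
open import Relation.Binary.PropositionalEquality
  using (_≡_; _≢_; refl; cong; sym; trans; subst; module ≡-Reasoning)
open import Relation.Nullary using (Dec; does; yes; no; ¬_; _×-dec_; _⊎-dec_; ¬?; contradiction)
open import Relation.Nullary.Decidable using (dec-true; dec-false; decidable-stable)
open import Relation.Unary using (Pred; Decidable)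

open import Algebra.Properties.CommutativeSemigroup *-commutativeSemigroup
  using (interchange; x∙yz≈y∙xz; xy∙z≈xz∙y)
open import Algebra.Properties.Semiring.Sum +-*-semiring
  using (sum; sum-syntax; ∑-distrib-+; ∑-comm; *-distribˡ-sum; sum-cong-≗; sum-replicate-zero)

module _ {n : ℕ} where
  open import Data.List.Membership.DecPropositional (_≟_ {n}) using (_∈?_) public

private variable
  ℓ ℓ′ : Level
  A : Set ℓ
  B : Set ℓ′
  j k n : ℕ

-- Inequalities

-- Bernoulli's inequality (1 + c/b)^t ≥ 1 + t c/b, multiplied by b^(t+1).
bernoulli : ∀ b c t → b ^ t * (b + t * c) ≤ b * (b + c) ^ t
bernoulli b c zero    = ≤-reflexive (base b c)
  where
  base : ∀ b c → 1 * (b + 0 * c) ≡ b * 1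
  base = solve-∀
bernoulli b c (suc t) = begin
  b * b ^ t * (b + suc t * c)                   ≡⟨ expand b c t (b ^ t) ⟩
  b * (b ^ t * (b + t * c)) + b * b ^ t * c     ≤⟨ +-mono-≤ (*-monoʳ-≤ b (bernoulli b c t)) b*b^t*c≤ ⟩
  b * (b * (b + c) ^ t) + b * (b + c) ^ t * c   ≡⟨ collect b c ((b + c) ^ t) ⟩
  b * ((b + c) * (b + c) ^ t)                   ∎
  where
  open ≤-Reasoning
  expand : ∀ b c t x → b * x * (b + suc t * c) ≡ b * (x * (b + t * c)) + b * x * c
  expand = solve-∀
  collect : ∀ b c x → b * (b * x) + b * x * c ≡ b * ((b + c) * x)
  collect = solve-∀
  b*b^t*c≤ : b * b ^ t * c ≤ b * (b + c) ^ t * c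
  b*b^t*c≤ = *-monoˡ-≤ c (*-monoʳ-≤ b (^-monoˡ-≤ t (m≤m+n b c)))

2*b^t≤[b+c]^t : ∀ {b c} t → 1 ≤ b → b ≤ t * c → 2 * b ^ t ≤ (b + c) ^ t
2*b^t≤[b+c]^t {b} {c} t 1≤b b≤tc = *-cancelˡ-≤ b {{>-nonZero 1≤b}} (begin
  b * (2 * b ^ t)      ≡⟨ double b (b ^ t) ⟩
  b ^ t * (b + b)      ≤⟨ *-monoʳ-≤ (b ^ t) (+-monoʳ-≤ b b≤tc) ⟩
  b ^ t * (b + t * c)  ≤⟨ bernoulli b c t ⟩
  b * (b + c) ^ t      ∎)
  where
  open ≤-Reasoning
  double : ∀ b x → b * (2 * x) ≡ x * (b + b)
  double = solve-∀

^-distribʳ-* : ∀ x y r → (x * y) ^ r ≡ x ^ r * y ^ r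
^-distribʳ-* x y zero    = refl
^-distribʳ-* x y (suc r) =
  trans (cong (x * y *_) (^-distribʳ-* x y r)) (interchange x y (x ^ r) (y ^ r))

2^r*b^e≤[b+c]^e : ∀ {b c t r e} → 1 ≤ b → b ≤ t * c → t * r ≤ e → 2 ^ r * b ^ e ≤ (b + c) ^ e
2^r*b^e≤[b+c]^e {b} {c} {t} {r} {e} 1≤b b≤tc tr≤e = begin
  2 ^ r * b ^ e                     ≡⟨ cong (2 ^ r *_) (split b) ⟩
  2 ^ r * (b ^ (t * r) * b ^ d)     ≡⟨ sym (*-assoc (2 ^ r) _ _) ⟩
  2 ^ r * b ^ (t * r) * b ^ d       ≡⟨ cong (λ x → 2 ^ r * x * b ^ d) (sym (^-*-assoc b t r)) ⟩
  2 ^ r * (b ^ t) ^ r * b ^ d       ≡⟨ cong (_* b ^ d) (sym (^-distribʳ-* 2 (b ^ t) r)) ⟩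
  (2 * b ^ t) ^ r * b ^ d           ≤⟨ *-mono-≤ (^-monoˡ-≤ r (2*b^t≤[b+c]^t t 1≤b b≤tc))
                                                (^-monoˡ-≤ d (m≤m+n b c)) ⟩
  ((b + c) ^ t) ^ r * (b + c) ^ d   ≡⟨ cong (_* (b + c) ^ d) (^-*-assoc (b + c) t r) ⟩
  (b + c) ^ (t * r) * (b + c) ^ d   ≡⟨ sym (split (b + c)) ⟩
  (b + c) ^ e                       ∎
  where
  open ≤-Reasoning
  d : ℕ
  d = e ∸ t * r
  split : ∀ x → x ^ e ≡ x ^ (t * r) * x ^ d
  split x = trans (cong (x ^_) (sym (m+[n∸m]≡n tr≤e))) (^-distribˡ-+-* x (t * r) d)

-- With t = ⌊m/k⌋ we have (m/(m−k))^t ≥ 2, hence (m/(m−k))^k ≥ 2^r > m².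
m²[m∸k]^k<m^k : ∀ {m k r} → 1 ≤ k → k < m → m * r ≤ k * k → m * m < 2 ^ r →
                m * m * (m ∸ k) ^ k < m ^ k
m²[m∸k]^k<m^k {m} {k} {r} 1≤k k<m mr≤k² m²<2^r = begin-strict
  m * m * b ^ k    <⟨ *-monoˡ-< (b ^ k) {{m^n≢0 b k {{>-nonZero 1≤b}}}} m²<2^r ⟩
  2 ^ r * b ^ k    ≤⟨ 2^r*b^e≤[b+c]^e {t = t} {r} 1≤b b≤tk tr≤k ⟩
  (b + k) ^ k      ≡⟨ cong (_^ k) b+k≡m ⟩
  m ^ k            ∎
  where
  open ≤-Reasoning
  instance
    k≢0 : NonZero k
    k≢0 = >-nonZero 1≤k
  b t : ℕ
  b = m ∸ k
  t = m / k
  b+k≡m : b + k ≡ m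
  b+k≡m = m∸n+n≡m (<⇒≤ k<m)
  1≤b : 1 ≤ b
  1≤b = m<n⇒0<n∸m k<m
  b≤tk : b ≤ t * k
  b≤tk = <⇒≤ (+-cancelʳ-< k b (t * k) (begin-strict
    b + k              ≡⟨ b+k≡m ⟩
    m                  ≡⟨ m≡m%n+[m/n]*n m k ⟩
    m % k + t * k      <⟨ +-monoˡ-< (t * k) (m%n<n m k) ⟩
    k + t * k          ≡⟨ +-comm k (t * k) ⟩
    t * k + k          ∎))
  tr≤k : t * r ≤ k
  tr≤k = *-cancelʳ-≤ (t * r) k k (begin
    t * r * k          ≡⟨ xy∙z≈xz∙y t r k ⟩
    t * k * r          ≤⟨ *-monoˡ-≤ r (m/n*n≤m m k) ⟩
    m * r              ≤⟨ mr≤k² ⟩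
    k * k              ∎)

⌊log₂⌋-bounds : ∀ m → 1 ≤ m → ∃ λ L → 2 ^ L ≤ m × m < 2 ^ suc L
⌊log₂⌋-bounds (suc zero)    _ = 0 , ≤-refl , ≤-refl
⌊log₂⌋-bounds (suc (suc m)) _ with ⌊log₂⌋-bounds (suc m) (s≤s z≤n)
... | L , 2^L≤ , <2^[1+L] with suc (suc m) <? 2 ^ suc L
...   | yes <2^[1+L]′ = L , ≤-trans 2^L≤ (n≤1+n _) , <2^[1+L]′
...   | no ≮2^[1+L]   = suc L , ≤-reflexive (sym m≡2^[1+L]) ,
                        subst (_< 2 ^ suc (suc L)) (sym m≡2^[1+L]) (^-monoʳ-< 2 ≤-refl (n<1+n (suc L)))
  where
  m≡2^[1+L] : suc (suc m) ≡ 2 ^ suc L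
  m≡2^[1+L] = ≤-antisym <2^[1+L] (≮⇒≥ ≮2^[1+L])

⌈√⌉-bounds : ∀ N M → N ≤ M * M → ∃ λ k → k ≤ M × N ≤ k * k × k * k ≤ N + 2 * k
⌈√⌉-bounds zero    M _ = 0 , z≤n , z≤n , z≤n
⌈√⌉-bounds (suc N) M 1+N≤M² with ⌈√⌉-bounds N M (≤-trans (n≤1+n N) 1+N≤M²)
... | k , k≤M , N≤k² , k²≤ with suc N ≤? k * k
...   | yes 1+N≤k² = k , k≤M , 1+N≤k² , ≤-trans k²≤ (n≤1+n _)
...   | no 1+N≰k²  = suc k , 1+k≤M , ≤-trans (m≤m+n (suc N) (2 * k)) (≤-reflexive (sym [1+k]²≡)) ,
                     ≤-trans (≤-reflexive [1+k]²≡) (+-monoʳ-≤ (suc N) (*-monoʳ-≤ 2 (n≤1+n k)))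
  where
  k²≡N : k * k ≡ N
  k²≡N = ≤-antisym (≤-pred (≰⇒> 1+N≰k²)) N≤k²
  square-suc : ∀ k → suc k * suc k ≡ suc (k * k + 2 * k)
  square-suc = solve-∀
  [1+k]²≡ : suc k * suc k ≡ suc N + 2 * k
  [1+k]²≡ = trans (square-suc k) (cong (λ x → suc (x + 2 * k)) k²≡N)
  1+k≤M : suc k ≤ M
  1+k≤M with suc k ≤? M
  ... | yes 1+k≤M = 1+k≤M
  ... | no 1+k≰M  = contradiction 1+N≤M² (<⇒≱ (begin-strict
    M * M   ≤⟨ *-mono-≤ M≤k M≤k ⟩
    k * k   ≡⟨ k²≡N ⟩
    N       <⟨ n<1+n N ⟩
    suc N   ∎))
    where
    open ≤-Reasoning
    M≤k : M ≤ k
    M≤k = ≤-pred (≰⇒> 1+k≰M)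

2[1+n]≤2^n : ∀ n → 3 ≤ n → 2 * suc n ≤ 2 ^ n
2[1+n]≤2^n n 3≤n = subst (λ n → 2 * suc n ≤ 2 ^ n) (m+[n∸m]≡n 3≤n) (from3 (n ∸ 3))
  where
  from3 : ∀ l → 2 * suc (3 + l) ≤ 2 ^ (3 + l)
  from3 zero    = ≤-refl
  from3 (suc l) = begin
    2 * suc (4 + l)           ≡⟨ *-suc 2 (4 + l) ⟩
    2 + 2 * (4 + l)           ≤⟨ +-mono-≤ (^-monoʳ-≤ 2 {1} {3 + l} (s≤s z≤n)) (from3 l) ⟩
    2 ^ (3 + l) + 2 ^ (3 + l) ≡⟨ cong (2 ^ (3 + l) +_) (sym (+-identityʳ _)) ⟩
    2 ^ (4 + l)               ∎
    where open ≤-Reasoning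

1≤m*m⇒1≤m : ∀ {m} → 1 ≤ m * m → 1 ≤ m
1≤m*m⇒1≤m {suc m} _ = s≤s z≤n

m*n<n⇒m≡0 : ∀ {m n} → m * n < n → m ≡ 0
m*n<n⇒m≡0 {zero}      _  = refl
m*n<n⇒m≡0 {suc m} {n} lt = contradiction lt (≤⇒≯ (m≤m+n n (m * n)))

n*b′≤[n∸k]*b : ∀ n k {b} b′ s → b′ + s ≡ b → k * b ≤ n * s → n * b′ ≤ (n ∸ k) * b
n*b′≤[n∸k]*b n k {b} b′ s b′+s≡b kb≤ns = begin
  n * b′           ≡⟨ cong (n *_) (trans (sym (m+n∸n≡m b′ s)) (cong (_∸ s) b′+s≡b)) ⟩
  n * (b ∸ s)      ≡⟨ *-distribˡ-∸ n b s ⟩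
  n * b ∸ n * s    ≤⟨ ∸-monoʳ-≤ (n * b) kb≤ns ⟩
  n * b ∸ k * b    ≡⟨ sym (*-distribʳ-∸ b n k) ⟩
  (n ∸ k) * b      ∎
  where open ≤-Reasoning

-- Counting

𝟙 : Dec A → ℕ
𝟙 a? = if does a? then 1 else 0

count : ∀ {p} {P : Pred (Fin n) p} → Decidable P → ℕ
count {n} P? = ∑[ i < n ] 𝟙 (P? i)

∑-mono-≤ : ∀ {f g : Fin n → ℕ} → (∀ i → f i ≤ g i) → sum f ≤ sum g
∑-mono-≤ {zero}  f≤g = z≤n
∑-mono-≤ {suc n} f≤g = +-mono-≤ (f≤g zero) (∑-mono-≤ (f≤g ∘ suc))

∑-const : ∀ n c → ∑[ i < n ] c ≡ n * c
∑-const zero    c = refl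
∑-const (suc n) c = cong (c +_) (∑-const n c)

∑≡0⇒≡0 : ∀ (f : Fin n → ℕ) → sum f ≡ 0 → ∀ i → f i ≡ 0
∑≡0⇒≡0 f ∑f≡0 zero    = m+n≡0⇒m≡0 (f zero) ∑f≡0
∑≡0⇒≡0 f ∑f≡0 (suc i) = ∑≡0⇒≡0 (f ∘ suc) (m+n≡0⇒n≡0 (f zero) ∑f≡0) i

∑≤*argmax : ∀ (f : Fin n → ℕ) → Fin n → ∃ λ i → sum f ≤ n * f i
∑≤*argmax {suc zero}    f _ = zero , ≤-refl
∑≤*argmax {suc (suc n)} f _ with ∑≤*argmax (f ∘ suc) zero
... | j , ∑≤ with f zero ≤? f (suc j)
...   | yes f₀≤ = suc j , +-mono-≤ f₀≤ ∑≤
...   | no f₀≰  = zero , +-monoʳ-≤ (f zero) (≤-trans ∑≤ (*-monoʳ-≤ (suc n) (<⇒≤ (≰⇒> f₀≰))))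

module _ {p q} {P : Pred (Fin n) p} {Q : Pred (Fin n) q} (P? : Decidable P) (Q? : Decidable Q) where

  count-mono : (∀ {i} → P i → Q i) → count P? ≤ count Q?
  count-mono P⊆Q = ∑-mono-≤ λ i → 𝟙-mono (P? i) (Q? i)
    where
    𝟙-mono : ∀ {i} (a? : Dec (P i)) (b? : Dec (Q i)) → 𝟙 a? ≤ 𝟙 b?
    𝟙-mono (yes _)  (yes _) = ≤-refl
    𝟙-mono (yes Pi) (no ¬Qi) = contradiction (P⊆Q Pi) ¬Qi
    𝟙-mono (no _)   _       = z≤n

  count-⊎ : count (λ i → P? i ⊎-dec Q? i) ≤ count P? + count Q?
  count-⊎ = ≤-trans (∑-mono-≤ λ i → 𝟙-⊎ (P? i) (Q? i)) (≤-reflexive (∑-distrib-+ (𝟙 ∘ P?) (𝟙 ∘ Q?)))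
    where
    𝟙-⊎ : (a? : Dec A) (b? : Dec B) → 𝟙 (a? ⊎-dec b?) ≤ 𝟙 a? + 𝟙 b?
    𝟙-⊎ (yes _) _       = s≤s z≤n
    𝟙-⊎ (no _)  (yes _) = ≤-refl
    𝟙-⊎ (no _)  (no _)  = ≤-refl

  count-split : count (λ i → P? i ×-dec Q? i) + count (λ i → P? i ×-dec ¬? (Q? i)) ≡ count P?
  count-split = trans (sym (∑-distrib-+ (λ i → 𝟙 (P? i ×-dec Q? i)) (λ i → 𝟙 (P? i ×-dec ¬? (Q? i)))))
                      (sum-cong-≗ λ i → 𝟙-split (P? i) (Q? i))
    where
    𝟙-split : (a? : Dec A) (b? : Dec B) → 𝟙 (a? ×-dec b?) + 𝟙 (a? ×-dec ¬? b?) ≡ 𝟙 a?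
    𝟙-split (yes _) (yes _) = refl
    𝟙-split (yes _) (no _)  = refl
    𝟙-split (no _)  _       = refl

module _ {p} {P : Pred (Fin n) p} (P? : Decidable P) where

  count≤ : count P? ≤ n
  count≤ = ≤-trans (∑-mono-≤ (𝟙≤1 ∘ P?)) (≤-reflexive (trans (∑-const n 1) (*-identityʳ n)))
    where
    𝟙≤1 : (a? : Dec A) → 𝟙 a? ≤ 1
    𝟙≤1 (yes _) = ≤-refl
    𝟙≤1 (no _)  = z≤n

  count-complement : count P? + count (¬? ∘ P?) ≡ n
  count-complement = begin
    count P? + count (¬? ∘ P?)             ≡⟨ sym (∑-distrib-+ (𝟙 ∘ P?) (𝟙 ∘ ¬? ∘ P?)) ⟩
    ∑[ i < n ] (𝟙 (P? i) + 𝟙 (¬? (P? i)))  ≡⟨ sum-cong-≗ (𝟙-complement ∘ P?) ⟩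
    ∑[ i < n ] 1                           ≡⟨ ∑-const n 1 ⟩
    n * 1                                  ≡⟨ *-identityʳ n ⟩
    n                                      ∎
    where
    open ≡-Reasoning
    𝟙-complement : (a? : Dec A) → 𝟙 a? + 𝟙 (¬? a?) ≡ 1
    𝟙-complement (yes _) = refl
    𝟙-complement (no _)  = refl

  count≡0⇒¬ : count P? ≡ 0 → ∀ i → ¬ P i
  count≡0⇒¬ count≡0 i Pi with P? i | ∑≡0⇒≡0 (𝟙 ∘ P?) count≡0 i
  ... | yes _  | ()
  ... | no ¬Pi | _  = ¬Pi Pi

  count<⇒∃¬ : count P? < n → ∃ λ i → ¬ P i
  count<⇒∃¬ count<n = ¬∀⟶∃¬ n P P? λ ∀P → <-irrefl (all⇒count≡n ∀P) count<n
    where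
    all⇒count≡n : (∀ i → P i) → count P? ≡ n
    all⇒count≡n ∀P = trans (sum-cong-≗ (𝟙-yes ∘ P?)) (trans (∑-const n 1) (*-identityʳ n))
      where
      𝟙-yes : ∀ {i} (a? : Dec (P i)) → 𝟙 a? ≡ 1
      𝟙-yes (yes _)  = refl
      𝟙-yes (no ¬Pi) = contradiction (∀P _) ¬Pi

count-≟ : ∀ (v : Fin n) → count (_≟ v) ≡ 1
count-≟ {suc n} zero    = cong suc (sum-replicate-zero n)
count-≟ {suc n} (suc v) = count-≟ v

count-∈≤length : ∀ (U : List (Fin n)) → count (_∈? U) ≤ length U
count-∈≤length {n} []  = ≤-reflexive (sum-replicate-zero n)
count-∈≤length (x ∷ U) = begin
  count (_∈? x ∷ U)                 ≤⟨ count-mono (_∈? x ∷ U) (λ i → i ≟ x ⊎-dec i ∈? U) toSum ⟩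
  count (λ i → i ≟ x ⊎-dec i ∈? U)  ≤⟨ count-⊎ (_≟ x) (_∈? U) ⟩
  count (_≟ x) + count (_∈? U)      ≤⟨ +-mono-≤ (≤-reflexive (count-≟ x)) (count-∈≤length U) ⟩
  suc (length U)                    ∎
  where open ≤-Reasoning

*𝟙≤count : ∀ {q} {Q : Pred (Fin n) q} (a? : Dec A) (Q? : Decidable Q) →
           (A → k ≤ count Q?) → k * 𝟙 a? ≤ count (λ i → a? ×-dec Q? i)
*𝟙≤count {k = k} (yes a) Q? k≤ = ≤-trans (≤-reflexive (*-identityʳ k)) (k≤ a)
*𝟙≤count {k = k} (no _)  Q? k≤ = ≤-trans (≤-reflexive (*-zeroʳ k)) z≤n

record Enumeration {p} (P : Pred (Fin n) p) (k : ℕ) : Set p where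
  field
    element   : Fin k → Fin n
    injective : Injective _≡_ _≡_ element
    sound     : ∀ i → P (element i)
    complete  : ∀ {x} → P x → ∃ λ i → element i ≡ x

enumerate : ∀ {p} {P : Pred (Fin n) p} (P? : Decidable P) → Enumeration P (count P?)
enumerate {zero}          P? = record
  { element = λ () ; injective = λ { {()} } ; sound = λ () ; complete = λ { {()} } }
enumerate {suc n} {P = P} P? = extend (P? zero) (enumerate (P? ∘ suc))
  where
  extend : (P₀? : Dec (P zero)) → Enumeration (P ∘ suc) k → Enumeration P (𝟙 P₀? + k)
  extend (no ¬P₀) E = record
    { element   = suc ∘ element
    ; injective = injective ∘ suc-injective
    ; sound     = sound
    ; complete  = λ { {zero} P₀ → contradiction P₀ ¬P₀
                    ; {suc x} Px → Product.map₂ (cong suc) (complete Px) }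
    }
    where open Enumeration E
  extend (yes P₀) E = record
    { element   = λ { zero → zero ; (suc i) → suc (element i) }
    ; injective = λ { {zero} {zero} _ → refl
                    ; {suc i} {suc j} eq → cong suc (injective (suc-injective eq)) }
    ; sound     = λ { zero → P₀ ; (suc i) → sound i }
    ; complete  = λ { {zero} _ → zero , refl
                    ; {suc x} Px → Product.map suc (cong suc) (complete Px) }
    }
    where open Enumeration E

-- Functionality in graphs

induced : Graph n → (Fin k → Fin n) → Graph k
induced G e = record
  { adj    = λ i j → adj G (e i) (e j)
  ; sym    = λ i j → Graph.sym G (e i) (e j)
  ; irrefl = irrefl G ∘ e
  }

funVertexLe-mono : ∀ (G : Graph n) S v → j ≤ k → FunVertexLe G S v j → FunVertexLe G S v k
funVertexLe-mono G S v j≤k (i , i≤j , u , isFunction) = i , ≤-trans i≤j j≤k , u , isFunction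

module _ (G : Graph n) {S : Subset n} (E : Enumeration (Subset._∈ S) k) where
  open Enumeration E

  funVertexLe-induced : ∀ {v} → FunVertexLe (induced G element) ⊤ v j → FunVertexLe G S (element v) j
  funVertexLe-induced {v = v} (i , i≤j , u , u-injective , _ , u≢v , f , f-correct) =
    i , i≤j , element ∘ u , u-injective ∘ injective , sound ∘ u , (λ i → u≢v i ∘ injective) , f ,
    λ w w∈S w≢v w∉u → lift (complete w∈S) w≢v w∉u
    where
    lift : ∀ {w} → ∃ (λ x → element x ≡ w) → w ≢ element v → (∀ i → w ≢ element (u i)) →
           adj G (element v) w ≡ f (λ i → adj G w (element (u i)))
    lift (x , refl) x≢v x∉u = f-correct x ∈⊤ (x≢v ∘ cong element) (λ i → x∉u i ∘ cong element)

module _ (H : Graph n) where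

  DeterminedBy : ∀ {p} → Fin n → Pred (Fin n) p → Set p
  DeterminedBy v D = ∀ {w w′} → ¬ D w → ¬ D w′ → w ≢ v → w′ ≢ v →
    (∀ {z} → D z → adj H w z ≡ adj H w′ z) → adj H v w ≡ adj H v w′

  determinedBy⇒funVertexLe : ∀ {p v} {D : Pred (Fin n) p} (D? : Decidable D) →
    ¬ D v → DeterminedBy v D → FunVertexLe H ⊤ v (count D?)
  determinedBy⇒funVertexLe {p} {v} {D} D? ¬Dv determined =
    count D? , ≤-refl , element , injective , (λ _ → ∈⊤) , (λ i eq → ¬Dv (subst D eq (sound i))) ,
    f , λ w _ w≢v w∉D → f-correct w≢v (λ Dw → let (i , eq) = complete Dw in w∉D i (sym eq))
    where
    open Enumeration (enumerate D?)

    profile : Fin n → Fin (count D?) → Bool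
    profile w i = adj H w (element i)

    -- f answers whether some vertex outside D ∪ {v} with the given profile on D is adjacent
    -- to v; by DeterminedBy the answer does not depend on which such vertex is chosen.
    Witness : (Fin (count D?) → Bool) → Pred (Fin n) p
    Witness bits w = (¬ D w × w ≢ v) × (∀ i → profile w i ≡ bits i) × adj H v w ≡ true

    witness? : ∀ bits → Decidable (Witness bits)
    witness? bits w = (¬? (D? w) ×-dec ¬? (w ≟ v)) ×-dec all? (λ i → profile w i Bool.≟ bits i)
                      ×-dec adj H v w Bool.≟ true

    f : (Fin (count D?) → Bool) → Bool
    f bits = does (any? (witness? bits))

    agree : ∀ {w w′} → (∀ i → profile w′ i ≡ profile w i) → ∀ {z} → D z → adj H w z ≡ adj H w′ z
    agree same Dz with complete Dz
    ... | i , refl = sym (same i)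

    f-correct : ∀ {w} → w ≢ v → ¬ D w → adj H v w ≡ f (profile w)
    f-correct {w} w≢v ¬Dw with adj H v w in vw
    ... | true  = sym (dec-true (any? (witness? (profile w))) (w , (¬Dw , w≢v) , (λ _ → refl) , vw))
    ... | false = sym (dec-false (any? (witness? (profile w))) λ (w′ , (¬Dw′ , w′≢v) , same , vw′) →
      contradiction (trans (sym vw) (trans (determined ¬Dw ¬Dw′ w≢v w′≢v (agree same)) vw′)) λ ())

  funVertexLe-others : ∀ {k} v → n ≤ suc k → FunVertexLe H ⊤ v k
  funVertexLe-others {k} v n≤1+k = funVertexLe-mono H ⊤ v count≤k
    (determinedBy⇒funVertexLe D? (λ v≢v → v≢v refl) λ ¬w≢v _ w≢v _ _ → contradiction w≢v ¬w≢v)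
    where
    D? : Decidable (_≢ v)
    D? = ¬? ∘ (_≟ v)
    count≤k : count D? ≤ k
    count≤k = ≤-pred (≤-trans (≤-reflexive (trans (cong (_+ count D?) (sym (count-≟ v)))
                                                   (count-complement (_≟ v))))
                              n≤1+k)

  Differs : Fin n → Fin n → Pred (Fin n) 0ℓ
  Differs x y z = adj H x z ≢ adj H y z

  differs? : ∀ x y → Decidable (Differs x y)
  differs? x y z = ¬? (adj H x z Bool.≟ adj H y z)

  funVertexLe-twin : ∀ {k x y} → x ≢ y → count (differs? x y) < k → FunVertexLe H ⊤ x k
  funVertexLe-twin {k} {x} {y} x≢y few = funVertexLe-mono H ⊤ x count≤k
    (determinedBy⇒funVertexLe D? (λ (x≢x , _) → x≢x refl) determined)
    where
    D : Pred (Fin n) 0ℓ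
    D z = z ≢ x × (z ≡ y ⊎ Differs x y z)
    D? : Decidable D
    D? z = ¬? (z ≟ x) ×-dec (z ≟ y ⊎-dec differs? x y z)

    count≤k : count D? ≤ k
    count≤k = begin
      count D?                                 ≤⟨ count-mono D? (λ z → z ≟ y ⊎-dec differs? x y z) proj₂ ⟩
      count (λ z → z ≟ y ⊎-dec differs? x y z) ≤⟨ count-⊎ (_≟ y) (differs? x y) ⟩
      count (_≟ y) + count (differs? x y)      ≡⟨ cong (_+ count (differs? x y)) (count-≟ y) ⟩
      suc (count (differs? x y))               ≤⟨ few ⟩
      k                                        ∎
      where open ≤-Reasoning

    twin : ∀ {w} → ¬ D w → w ≢ x → adj H x w ≡ adj H y w
    twin ¬Dw w≢x = decidable-stable (adj H x _ Bool.≟ adj H y _) λ differ → ¬Dw (w≢x , inj₂ differ)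

    determined : DeterminedBy x D
    determined {w} {w′} ¬Dw ¬Dw′ w≢x w′≢x agree = begin
      adj H x w  ≡⟨ twin ¬Dw w≢x ⟩
      adj H y w  ≡⟨ Graph.sym H y w ⟩
      adj H w y  ≡⟨ agree (x≢y ∘ sym , inj₁ refl) ⟩
      adj H w′ y ≡⟨ Graph.sym H w′ y ⟩
      adj H y w′ ≡⟨ sym (twin ¬Dw′ w′≢x) ⟩
      adj H x w′ ∎
      where open ≡-Reasoning

-- Separating sets

module _ (H : Graph n) where

  -- The base case records x ≢ y, so badPairs counts ordered pairs of distinct vertices.
  Unseparated : List (Fin n) → Fin n → Fin n → Set
  Unseparated []      x y = x ≢ y
  Unseparated (z ∷ U) x y = Unseparated U x y × adj H x z ≡ adj H y z

  unseparated? : ∀ U x y → Dec (Unseparated U x y)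
  unseparated? []      x y = ¬? (x ≟ y)
  unseparated? (z ∷ U) x y = unseparated? U x y ×-dec adj H x z Bool.≟ adj H y z

  unseparated⁺ : ∀ U {x y} → x ≢ y → (∀ {z} → z ∈ U → adj H x z ≡ adj H y z) → Unseparated U x y
  unseparated⁺ []      x≢y _     = x≢y
  unseparated⁺ (z ∷ U) x≢y agree = unseparated⁺ U x≢y (agree ∘ there) , agree (here refl)

  unseparated⇒≢ : ∀ U {x y} → Unseparated U x y → x ≢ y
  unseparated⇒≢ []      x≢y         = x≢y
  unseparated⇒≢ (z ∷ U) (unsep , _) = unseparated⇒≢ U unsep

  badPairs : List (Fin n) → ℕ
  badPairs U = ∑[ x < n ] count (unseparated? U x)

  splitBy : List (Fin n) → Fin n → ℕ
  splitBy U z = ∑[ x < n ] count (λ y → unseparated? U x y ×-dec differs? H x y z)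

  badPairs-∷ : ∀ U z → badPairs (z ∷ U) + splitBy U z ≡ badPairs U
  badPairs-∷ U z = trans (sym (∑-distrib-+ (count ∘ unseparated? (z ∷ U)) (splitBy-from U z)))
                         (sum-cong-≗ λ x → count-split (unseparated? U x) (λ y → adj H x z Bool.≟ adj H y z))
    where
    splitBy-from : List (Fin n) → Fin n → Fin n → ℕ
    splitBy-from U z x = count (λ y → unseparated? U x y ×-dec differs? H x y z)

  separated⇒funVertexLe : ∀ {U} → length U < n → (∀ x y → ¬ Unseparated U x y) →
    ∃ λ v → FunVertexLe H ⊤ v (length U)
  separated⇒funVertexLe {U} |U|<n separated with count<⇒∃¬ (_∈? U) (≤-<-trans (count-∈≤length U) |U|<n)
  ... | v , v∉U = v , funVertexLe-mono H ⊤ v (count-∈≤length U)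
                        (determinedBy⇒funVertexLe H (_∈? U) v∉U determined)
    where
    determined : DeterminedBy H v (_∈ U)
    determined {w} {w′} _ _ _ _ agree with w ≟ w′
    ... | yes refl = refl
    ... | no w≢w′  = contradiction (unseparated⁺ U w≢w′ agree) (separated w w′)

  module _ (spread : ∀ {x y} → x ≢ y → k ≤ count (differs? H x y)) where

    k*badPairs≤∑splitBy : ∀ U → k * badPairs U ≤ ∑[ z < n ] splitBy U z
    k*badPairs≤∑splitBy U = begin
      k * badPairs U
        ≡⟨ *-distribˡ-sum k (count ∘ unseparated? U) ⟩
      ∑[ x < n ] (k * count (unseparated? U x))
        ≡⟨ sum-cong-≗ {n} (λ x → *-distribˡ-sum k (𝟙 ∘ unseparated? U x)) ⟩
      ∑[ x < n ] ∑[ y < n ] (k * 𝟙 (unseparated? U x y))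
        ≤⟨ ∑-mono-≤ (λ x → ∑-mono-≤ λ y →
             *𝟙≤count (unseparated? U x y) (differs? H x y) (spread ∘ unseparated⇒≢ U)) ⟩
      ∑[ x < n ] ∑[ y < n ] ∑[ z < n ] 𝟙 (unseparated? U x y ×-dec differs? H x y z)
        ≡⟨ sum-cong-≗ {n} (λ x → ∑-comm (λ y z → 𝟙 (unseparated? U x y ×-dec differs? H x y z))) ⟩
      ∑[ x < n ] ∑[ z < n ] ∑[ y < n ] 𝟙 (unseparated? U x y ×-dec differs? H x y z)
        ≡⟨ ∑-comm (λ x z → count (λ y → unseparated? U x y ×-dec differs? H x y z)) ⟩
      ∑[ z < n ] splitBy U z
        ∎
      where open ≤-Reasoning

    greedy-step : Fin n → ∀ U → ∃ λ z → n * badPairs (z ∷ U) ≤ (n ∸ k) * badPairs U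
    greedy-step v U with ∑≤*argmax (splitBy U) v
    ... | z , ∑≤ = z , n*b′≤[n∸k]*b n k (badPairs (z ∷ U)) (splitBy U z) (badPairs-∷ U z)
                                    (≤-trans (k*badPairs≤∑splitBy U) ∑≤)

    greedy : Fin n → ∀ j → ∃ λ U → length U ≡ j × badPairs U * n ^ j ≤ n * n * (n ∸ k) ^ j
    greedy v zero = [] , refl , *-monoˡ-≤ 1 badPairs[]≤n²
      where
      badPairs[]≤n² : badPairs [] ≤ n * n
      badPairs[]≤n² = ≤-trans (∑-mono-≤ (count≤ ∘ unseparated? [])) (≤-reflexive (∑-const n n))
    greedy v (suc j) with greedy v j
    ... | U , refl , bound with greedy-step v U
    ...   | z , step = z ∷ U , refl , (begin
      badPairs (z ∷ U) * (n * n ^ j)       ≡⟨ x∙yz≈y∙xz (badPairs (z ∷ U)) n (n ^ j) ⟩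
      n * (badPairs (z ∷ U) * n ^ j)       ≡⟨ sym (*-assoc n _ _) ⟩
      n * badPairs (z ∷ U) * n ^ j         ≤⟨ *-monoˡ-≤ (n ^ j) step ⟩
      (n ∸ k) * badPairs U * n ^ j         ≡⟨ *-assoc (n ∸ k) _ _ ⟩
      (n ∸ k) * (badPairs U * n ^ j)       ≤⟨ *-monoʳ-≤ (n ∸ k) bound ⟩
      (n ∸ k) * (n * n * (n ∸ k) ^ j)      ≡⟨ x∙yz≈y∙xz (n ∸ k) (n * n) _ ⟩
      n * n * ((n ∸ k) * (n ∸ k) ^ j)      ∎)
      where open ≤-Reasoning

    separating-list : Fin n → n * n * (n ∸ k) ^ k < n ^ k →
      ∃ λ U → length U ≡ k × ∀ x y → ¬ Unseparated U x y
    separating-list v few with greedy v k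
    ... | U , |U|≡k , bound = U , |U|≡k , λ x → count≡0⇒¬ (unseparated? U x) (∑≡0⇒≡0 _ noBadPairs x)
      where
      noBadPairs : badPairs U ≡ 0
      noBadPairs = m*n<n⇒m≡0 (≤-<-trans bound few)

-- m² (1 − k/m)^k < 1: k greedy steps leave no unseparated pair.
SeparationBound : ℕ → ℕ → Set
SeparationBound m k = suc k < m → m * m * (m ∸ k) ^ k < m ^ k

low-functionality-vertex : (H : Graph n) → Fin n → SeparationBound n k → ∃ λ v → FunVertexLe H ⊤ v k
low-functionality-vertex {n} {k} H v₀ bound with n ≤? suc k
... | yes n≤1+k = v₀ , funVertexLe-others H v₀ n≤1+k
... | no n≰1+k with any? (λ x → any? (λ y → ¬? (x ≟ y) ×-dec count (differs? H x y) <? k))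
...   | yes (x , y , x≢y , few) = x , funVertexLe-twin H x≢y few
...   | no noTwins
  with separating-list H (λ x≢y → ≮⇒≥ λ few → noTwins (_ , _ , x≢y , few)) v₀ (bound (≰⇒> n≰1+k))
...     | U , refl , separated = separated⇒funVertexLe H (<-trans (n<1+n _) (≰⇒> n≰1+k)) separated

-- Choice of k

threshold : ℕ → ℕ
threshold q = 2 ^ (4 * q)

order-threshold : ℕ → ℕ
order-threshold q = q * (threshold q * threshold q) + 2

qk²≤pmL : ∀ {p q m k L} → 2 * q < p → 4 * q ≤ L → k ≤ m → k * k ≤ m * (2 * suc L) + 2 * k →
          q * (k * k) ≤ p * m * L
qk²≤pmL {p} {q} {m} {k} {L} 2q<p 4q≤L k≤m k²≤ = begin
  q * (k * k)                      ≤⟨ *-monoʳ-≤ q (≤-trans k²≤ (+-monoʳ-≤ (m * (2 * suc L)) 2k≤2m)) ⟩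
  q * (m * (2 * suc L) + 2 * m)    ≡⟨ expand q m L ⟩
  2 * q * m * L + 4 * q * m        ≤⟨ +-monoʳ-≤ (2 * q * m * L) (*-monoˡ-≤ m 4q≤L) ⟩
  2 * q * m * L + L * m            ≡⟨ collect q m L ⟩
  suc (2 * q) * m * L              ≤⟨ *-monoˡ-≤ L (*-monoˡ-≤ m 2q<p) ⟩
  p * m * L                        ∎
  where
  open ≤-Reasoning
  expand : ∀ q m L → q * (m * (2 * suc L) + 2 * m) ≡ 2 * q * m * L + 4 * q * m
  expand = solve-∀
  collect : ∀ q m L → 2 * q * m * L + L * m ≡ suc (2 * q) * m * L
  collect = solve-∀
  2k≤2m : 2 * k ≤ 2 * m
  2k≤2m = *-monoʳ-≤ 2 k≤m

module _ (p q : ℕ) .{{_ : NonZero q}} (2q<p : 2 * q < p) where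

  2^e≤n^pn : ∀ {e n} → 2 ≤ n → e ≤ p * n → 2 ^ e ≤ n ^ (p * n)
  2^e≤n^pn {n = n} 2≤n e≤pn = ≤-trans (^-monoʳ-≤ 2 e≤pn) (^-monoˡ-≤ (p * n) 2≤n)

  2^pmL≤n^pn : ∀ {m n L} → 1 ≤ m → 2 ^ L ≤ m → m ≤ n → 2 ^ (p * m * L) ≤ n ^ (p * n)
  2^pmL≤n^pn {m} {n} {L} 1≤m 2^L≤m m≤n = begin
    2 ^ (p * m * L)    ≡⟨ cong (2 ^_) (*-comm (p * m) L) ⟩
    2 ^ (L * (p * m))  ≡⟨ sym (^-*-assoc 2 L (p * m)) ⟩
    (2 ^ L) ^ (p * m)  ≤⟨ ^-monoˡ-≤ (p * m) (≤-trans 2^L≤m m≤n) ⟩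
    n ^ (p * m)        ≤⟨ ^-monoʳ-≤ n {{>-nonZero (≤-trans 1≤m m≤n)}} (*-monoʳ-≤ p m≤n) ⟩
    n ^ (p * n)        ∎
    where open ≤-Reasoning

  small-parameter : ∀ {m n} → 1 ≤ m → m < threshold q → order-threshold q ≤ n →
    WithinBound p q n (m ∸ 1) × SeparationBound m (m ∸ 1)
  small-parameter {m} {n} 1≤m m<T n₀≤n =
    2^e≤n^pn (≤-trans (m≤n+m 2 _) n₀≤n) exponent≤ ,
    λ m<m → contradiction m<m (<-irrefl (m+[n∸m]≡n 1≤m))
    where
    m∸1≤T : m ∸ 1 ≤ threshold q
    m∸1≤T = ≤-trans (m∸n≤m m 1) (<⇒≤ m<T)
    exponent≤ : q * ((m ∸ 1) * (m ∸ 1)) ≤ p * n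
    exponent≤ = begin
      q * ((m ∸ 1) * (m ∸ 1))          ≤⟨ *-monoʳ-≤ q (*-mono-≤ m∸1≤T m∸1≤T) ⟩
      q * (threshold q * threshold q)  ≤⟨ m≤m+n _ 2 ⟩
      order-threshold q                ≤⟨ n₀≤n ⟩
      n                                ≤⟨ m≤n*m n p {{>-nonZero (≤-trans (s≤s z≤n) 2q<p)}} ⟩
      p * n                            ∎
      where open ≤-Reasoning

  4q≤L : ∀ {m L} → threshold q ≤ m → m < 2 ^ suc L → 4 * q ≤ L
  4q≤L T≤m m<2^[1+L] =
    ≮⇒≥ λ L<4q → <-irrefl refl (<-≤-trans m<2^[1+L] (≤-trans (^-monoʳ-≤ 2 L<4q) T≤m))

  2[1+L]≤m : ∀ {m L} → threshold q ≤ m → 2 ^ L ≤ m → m < 2 ^ suc L → 2 * suc L ≤ m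
  2[1+L]≤m {L = L} T≤m 2^L≤m m<2^[1+L] = ≤-trans (2[1+n]≤2^n L 3≤L) 2^L≤m
    where
    3≤L : 3 ≤ L
    3≤L = ≤-trans (≤-trans (n≤1+n 3) (*-monoʳ-≤ 4 (>-nonZero⁻¹ q))) (4q≤L T≤m m<2^[1+L])

  -- k ≈ √(m r) with r = 2 (⌊log₂ m⌋ + 1), so that m² < 2^r and k² ≈ 2 m log₂ m.
  large-parameter′ : ∀ {m n L k} → threshold q ≤ m → m ≤ n → 2 ^ L ≤ m → m < 2 ^ suc L →
    k ≤ m → m * (2 * suc L) ≤ k * k → k * k ≤ m * (2 * suc L) + 2 * k →
    WithinBound p q n k × SeparationBound m k
  large-parameter′ {m} {n} {L} {k} T≤m m≤n 2^L≤m m<2^[1+L] k≤m mr≤k² k²≤ =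
    ≤-trans (^-monoʳ-≤ 2 (qk²≤pmL {q = q} 2q<p (4q≤L T≤m m<2^[1+L]) k≤m k²≤))
            (2^pmL≤n^pn 1≤m 2^L≤m m≤n) ,
    λ 1+k<m → m²[m∸k]^k<m^k 1≤k (<-trans (n<1+n k) 1+k<m) mr≤k² m²<2^r
    where
    1≤m : 1 ≤ m
    1≤m = ≤-trans (m^n>0 2 (4 * q)) T≤m
    1≤k : 1 ≤ k
    1≤k = 1≤m*m⇒1≤m (≤-trans (*-mono-≤ 1≤m (s≤s z≤n)) mr≤k²)
    m²<2^r : m * m < 2 ^ (2 * suc L)
    m²<2^r = begin-strict
      m * m                      <⟨ *-mono-< m<2^[1+L] m<2^[1+L] ⟩
      2 ^ suc L * 2 ^ suc L      ≡⟨ sym (^-distribˡ-+-* 2 (suc L) (suc L)) ⟩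
      2 ^ (suc L + suc L)        ≡⟨ cong (λ e → 2 ^ (suc L + e)) (sym (+-identityʳ (suc L))) ⟩
      2 ^ (2 * suc L)            ∎
      where open ≤-Reasoning

  large-parameter : ∀ {m n} → threshold q ≤ m → m ≤ n →
    ∃ λ k → WithinBound p q n k × SeparationBound m k
  large-parameter {m} {n} T≤m m≤n with ⌊log₂⌋-bounds m (≤-trans (m^n>0 2 (4 * q)) T≤m)
  ... | L , 2^L≤m , m<2^[1+L]
    with ⌈√⌉-bounds (m * (2 * suc L)) m (*-monoʳ-≤ m (2[1+L]≤m T≤m 2^L≤m m<2^[1+L]))
  ...   | k , k≤m , mr≤k² , k²≤ = k , large-parameter′ T≤m m≤n 2^L≤m m<2^[1+L] k≤m mr≤k² k²≤

  separation-parameter : ∀ {m n} → 1 ≤ m → m ≤ n → order-threshold q ≤ n →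
    ∃ λ k → WithinBound p q n k × SeparationBound m k
  separation-parameter {m} 1≤m m≤n n₀≤n with m <? threshold q
  ... | yes m<T = m ∸ 1 , small-parameter 1≤m m<T n₀≤n
  ... | no m≮T  = large-parameter (≮⇒≥ m≮T) m≤n

theorem2 : ∀ (p q : ℕ) → .{{_ : NonZero q}} → 2 * q < p →
    Σ ℕ λ n₀ → ∀ (n : ℕ) → n ≥ n₀ → (G : Graph n) → FunBounded G p q
theorem2 p q 2q<p = order-threshold q , λ n n₀≤n G S (x , x∈S) →
  let E = enumerate (Subset._∈? S)
      open Enumeration E
      i , _                    = complete x∈S
      k , within , separable   = separation-parameter p q 2q<p (>-nonZero⁻¹ _ {{nonZeroIndex i}})
                                                      (injective⇒≤ injective) n₀≤n
      v , funVertexLe          = low-functionality-vertex (induced G element) i separable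
  in element v , sound v , k , within , funVertexLe-induced G E funVertexLe
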